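{- Let $G$ be a finite nonabelian simple group, $x\in G$ an involution and $\alpha=\sigma_x$. Then the setwise stabilizer in $\mathrm{Aut}(G)$ of the conjugacy class $x^G=\{hxh^{ -1}:h\in G\}$ equals $\Delta_\alpha$, i.e. $\{\epsilon\in\mathrm{Aut}(G):\epsilon(x^G)=x^G\}=\Delta_\alpha$.
   Context: $\sigma_x$ is conjugation $y\mapsto xyx^{ -1}=xyx$. $\mathrm{Aut}(G)_\alpha=\{\gamma\in\mathrm{Aut}(G):\gamma\alpha=\alpha\gamma\}$ and $\Delta_\alpha=\mathrm{Inn}(G)\,\mathrm{Aut}(G)_\alpha$. (The paper writes the conjugacy class of $x$ as $\omega^*_x(G)=\{\{xg,g^{ -1}x^{ -1}\}: g\in\omega_\alpha(G)\}$ with $\omega_\alpha(G)=\{\alpha(h)h^{ -1}:h\in G\}$, which consists of the singletons $\{hxh^{ -1}\}$.) -}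

module Defs where

open import Level using (Level; _⊔_; suc)
open import Algebra.Bundles using (Group)
open import Algebra.Morphism.Structures using (module GroupMorphisms)
open import Data.Fin using (Fin)
open import Data.Nat using (ℕ)
open import Data.Product using (Σ; ∃; ∃-syntax; _×_; _,_)
open import Data.Sum using (_⊎_)
open import Relation.Nullary using (¬_)
open import Relation.Binary.PropositionalEquality using (_≡_)

module _ {c ℓ : Level} (G : Group c ℓ) where
  open Group G

  IsFiniteGroup : Set (c ⊔ ℓ)
  IsFiniteGroup = Σ ℕ λ n → Σ (Fin n → Carrier) λ e →
    (∀ y → ∃[ i ] e i ≈ y) × (∀ i j → e i ≈ e j → i ≡ j)

  IsNonabelian : Set (c ⊔ ℓ)
  IsNonabelian = ∃[ a ] ∃[ b ] ¬ (a ∙ b ≈ b ∙ a)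

  record IsNormalSubgroup (N : Carrier → Set (c ⊔ ℓ)) : Set (c ⊔ ℓ) where
    field
      resp    : ∀ {a b} → a ≈ b → N a → N b
      has-ε   : N ε
      closed∙ : ∀ {a b} → N a → N b → N (a ∙ b)
      closed⁻¹ : ∀ {a} → N a → N (a ⁻¹)
      conj    : ∀ g {a} → N a → N (g ∙ a ∙ g ⁻¹)

  IsSimple : Set (suc (c ⊔ ℓ))
  IsSimple = (¬ (∀ y → y ≈ ε)) ×
    (∀ (N : Carrier → Set (c ⊔ ℓ)) → IsNormalSubgroup N →
       (∀ y → N y → y ≈ ε) ⊎ (∀ y → N y))

  IsInvolution : Carrier → Set ℓ
  IsInvolution x = (x ∙ x ≈ ε) × ¬ (x ≈ ε)

  σ : Carrier → Carrier → Carrier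
  σ g y = g ∙ y ∙ g ⁻¹

  record Aut : Set (c ⊔ ℓ) where
    field
      fun : Carrier → Carrier
      isIso : GroupMorphisms.IsGroupIsomorphism rawGroup rawGroup fun
  open Aut public

  _∈Class_ : Carrier → Carrier → Set (c ⊔ ℓ)
  y ∈Class x = ∃[ h ] y ≈ h ∙ x ∙ h ⁻¹

  Stabilizes : Aut → Carrier → Set (c ⊔ ℓ)
  Stabilizes e x =
    (∀ y → y ∈Class x → fun e y ∈Class x) ×
    (∀ y → y ∈Class x → ∃[ z ] (z ∈Class x × fun e z ≈ y))

  Commutes : Aut → (Carrier → Carrier) → Set (c ⊔ ℓ)
  Commutes γ α = ∀ y → fun γ (α y) ≈ α (fun γ y)

  -- Δ_α = Inn(G) Aut(G)_α
  _∈Δ_ : Aut → (Carrier → Carrier) → Set (c ⊔ ℓ)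
  e ∈Δ α = ∃[ g ] Σ Aut λ γ → Commutes γ α × (∀ y → fun e y ≈ σ g (fun γ y))

module Submission where

-- Let e be an automorphism of a group G and x ∈ G.  We show that e maps the
-- class x^G onto itself iff e = σ_g ∘ γ for some g and some automorphism γ
-- commuting with σ_x, provided the centre of G is trivial; simple nonabelian
-- groups are centreless, which gives the theorem.
--
-- Then:
--   * if e x = σ_g x, then e stabilises x^G (images of conjugates are
--     conjugates, and surjectivity of e gives the reverse inclusion);
--   * if e stabilises x^G, write e x = σ_g x; then γ = σ_{g⁻¹} ∘ e fixes x,
--     hence commutes with σ_x, and e = σ_g ∘ γ;
--   * conversely, if γ commutes with σ_x then σ_{γ x} = σ_x, so γ x x⁻¹ is
--     central; in a centreless group γ x = x, hence e x = σ_g x.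

open import Defs
open import Level using (Level; _⊔_)
open import Algebra.Bundles using (Group)
open import Algebra.Morphism.Structures using (module GroupMorphisms)
open import Data.Product using (_×_; _,_; proj₁; proj₂; ∃-syntax)
open import Data.Sum using (inj₁; inj₂)
open import Data.Empty using (⊥-elim)
open import Function.Base using (_∘_)
open import Function.Bundles using (_⇔_; mk⇔)
import Algebra.Morphism.Construct.Composition as Composition
import Algebra.Properties.Group as GroupProperties
import Relation.Binary.Reasoning.Setoid as SetoidReasoning

module Conjugation {c ℓ : Level} (G : Group c ℓ) where
  open Group G
  open GroupProperties G
  open SetoidReasoning setoid
  open GroupMorphisms rawGroup rawGroup

  σ-congʳ : ∀ g {a b} → a ≈ b → σ G g a ≈ σ G g b
  σ-congʳ g p = ∙-congʳ (∙-congˡ p)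

  σ-congˡ : ∀ {g h} a → g ≈ h → σ G g a ≈ σ G h a
  σ-congˡ a p = ∙-cong (∙-congʳ p) (⁻¹-cong p)

  σ-identity : ∀ a → σ G ε a ≈ a
  σ-identity a = begin
    (ε ∙ a) ∙ ε ⁻¹ ≈⟨ ∙-cong (identityˡ a) ε⁻¹≈ε ⟩
    a ∙ ε          ≈⟨ identityʳ a ⟩
    a              ∎

  σ-∘ : ∀ g h a → σ G g (σ G h a) ≈ σ G (g ∙ h) a
  σ-∘ g h a = begin
    (g ∙ ((h ∙ a) ∙ h ⁻¹)) ∙ g ⁻¹ ≈⟨ ∙-congʳ (sym (assoc g (h ∙ a) (h ⁻¹))) ⟩
    ((g ∙ (h ∙ a)) ∙ h ⁻¹) ∙ g ⁻¹ ≈⟨ ∙-congʳ (∙-congʳ (sym (assoc g h a))) ⟩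
    (((g ∙ h) ∙ a) ∙ h ⁻¹) ∙ g ⁻¹ ≈⟨ assoc _ _ _ ⟩
    ((g ∙ h) ∙ a) ∙ (h ⁻¹ ∙ g ⁻¹) ≈⟨ ∙-congˡ (sym (⁻¹-anti-homo-∙ g h)) ⟩
    ((g ∙ h) ∙ a) ∙ (g ∙ h) ⁻¹    ∎

  σ-inverseˡ : ∀ g a → σ G (g ⁻¹) (σ G g a) ≈ a
  σ-inverseˡ g a = begin
    σ G (g ⁻¹) (σ G g a) ≈⟨ σ-∘ (g ⁻¹) g a ⟩
    σ G (g ⁻¹ ∙ g) a     ≈⟨ σ-congˡ a (inverseˡ g) ⟩
    σ G ε a              ≈⟨ σ-identity a ⟩
    a                    ∎

  σ-inverseʳ : ∀ g a → σ G g (σ G (g ⁻¹) a) ≈ a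
  σ-inverseʳ g a = begin
    σ G g (σ G (g ⁻¹) a) ≈⟨ σ-∘ g (g ⁻¹) a ⟩
    σ G (g ∙ g ⁻¹) a     ≈⟨ σ-congˡ a (inverseʳ g) ⟩
    σ G ε a              ≈⟨ σ-identity a ⟩
    a                    ∎

  σ-homo : ∀ g a b → σ G g (a ∙ b) ≈ σ G g a ∙ σ G g b
  σ-homo g a b = sym (begin
    ((g ∙ a) ∙ g ⁻¹) ∙ ((g ∙ b) ∙ g ⁻¹) ≈⟨ assoc _ _ _ ⟩
    (g ∙ a) ∙ (g ⁻¹ ∙ ((g ∙ b) ∙ g ⁻¹)) ≈⟨ ∙-congˡ (sym (assoc _ _ _)) ⟩
    (g ∙ a) ∙ ((g ⁻¹ ∙ (g ∙ b)) ∙ g ⁻¹) ≈⟨ ∙-congˡ (∙-congʳ (sym (assoc _ _ _))) ⟩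
    (g ∙ a) ∙ (((g ⁻¹ ∙ g) ∙ b) ∙ g ⁻¹) ≈⟨ ∙-congˡ (∙-congʳ (∙-congʳ (inverseˡ g))) ⟩
    (g ∙ a) ∙ ((ε ∙ b) ∙ g ⁻¹)          ≈⟨ ∙-congˡ (∙-congʳ (identityˡ b)) ⟩
    (g ∙ a) ∙ (b ∙ g ⁻¹)                ≈⟨ sym (assoc _ _ _) ⟩
    ((g ∙ a) ∙ b) ∙ g ⁻¹                ≈⟨ ∙-congʳ (assoc _ _ _) ⟩
    (g ∙ (a ∙ b)) ∙ g ⁻¹                ∎)

  σ-ε : ∀ g → σ G g ε ≈ ε
  σ-ε g = begin
    (g ∙ ε) ∙ g ⁻¹ ≈⟨ ∙-congʳ (identityʳ g) ⟩
    g ∙ g ⁻¹       ≈⟨ inverseʳ g ⟩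
    ε              ∎

  σ-⁻¹ : ∀ g a → σ G g (a ⁻¹) ≈ σ G g a ⁻¹
  σ-⁻¹ g a = inverseʳ-unique (σ G g a) (σ G g (a ⁻¹)) (begin
    σ G g a ∙ σ G g (a ⁻¹) ≈⟨ sym (σ-homo g a (a ⁻¹)) ⟩
    σ G g (a ∙ a ⁻¹)       ≈⟨ σ-congʳ g (inverseʳ a) ⟩
    σ G g ε                ≈⟨ σ-ε g ⟩
    ε                      ∎)

  σ-isGroupIsomorphism : ∀ g → IsGroupIsomorphism (σ G g)
  σ-isGroupIsomorphism g = record
    { isGroupMonomorphism = record
      { isGroupHomomorphism = record
        { isMonoidHomomorphism = record
          { isMagmaHomomorphism = record
            { isRelHomomorphism = record { cong = σ-congʳ g }
            ; homo = σ-homo g }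
          ; ε-homo = σ-ε g }
        ; ⁻¹-homo = σ-⁻¹ g }
      ; injective = λ {a} {b} p → begin
          a                    ≈⟨ sym (σ-inverseˡ g a) ⟩
          σ G (g ⁻¹) (σ G g a) ≈⟨ σ-congʳ (g ⁻¹) p ⟩
          σ G (g ⁻¹) (σ G g b) ≈⟨ σ-inverseˡ g b ⟩
          b                    ∎ }
    ; surjective = λ y → σ G (g ⁻¹) y , λ p → trans (σ-congʳ g p) (σ-inverseʳ g y) }

  conjugateAut : Carrier → Aut G → Aut G
  conjugateAut g e = record
    { fun   = σ G g ∘ fun e
    ; isIso = Composition.isGroupIsomorphism trans (isIso e) (σ-isGroupIsomorphism g) }

  homo-σ : ∀ {f} → IsGroupHomomorphism f → ∀ g a → f (σ G g a) ≈ σ G (f g) (f a)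
  homo-σ {f} hom g a = begin
    f ((g ∙ a) ∙ g ⁻¹)   ≈⟨ homo _ _ ⟩
    f (g ∙ a) ∙ f (g ⁻¹) ≈⟨ ∙-cong (homo g a) (⁻¹-homo g) ⟩
    (f g ∙ f a) ∙ f g ⁻¹ ∎
    where open IsGroupHomomorphism hom

  Central : Carrier → Set (c ⊔ ℓ)
  Central z = ∀ a → z ∙ a ≈ a ∙ z

  IsCenterless : Set (c ⊔ ℓ)
  IsCenterless = ∀ z → Central z → z ≈ ε

  central⇒σ-trivial : ∀ {z} → Central z → ∀ a → σ G a z ≈ z
  central⇒σ-trivial {z} central a = begin
    (a ∙ z) ∙ a ⁻¹ ≈⟨ ∙-congʳ (sym (central a)) ⟩
    (z ∙ a) ∙ a ⁻¹ ≈⟨ assoc _ _ _ ⟩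
    z ∙ (a ∙ a ⁻¹) ≈⟨ ∙-congˡ (inverseʳ a) ⟩
    z ∙ ε          ≈⟨ identityʳ z ⟩
    z              ∎

  σ-trivial⇒central : ∀ {z} → (∀ a → σ G z a ≈ a) → Central z
  σ-trivial⇒central {z} trivial a = begin
    z ∙ a                ≈⟨ sym (identityʳ _) ⟩
    (z ∙ a) ∙ ε          ≈⟨ ∙-congˡ (sym (inverseˡ z)) ⟩
    (z ∙ a) ∙ (z ⁻¹ ∙ z) ≈⟨ sym (assoc _ _ _) ⟩
    σ G z a ∙ z          ≈⟨ ∙-congʳ (trivial a) ⟩
    a ∙ z                ∎

  central-resp : ∀ {a b} → a ≈ b → Central a → Central b
  central-resp p central y = trans (∙-congʳ (sym p)) (trans (central y) (∙-congˡ p))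

  center-normal : IsNormalSubgroup G Central
  center-normal = record
    { resp     = central-resp
    ; has-ε    = λ a → trans (identityˡ a) (sym (identityʳ a))
    ; closed∙  = λ {a} {b} ca cb y → begin
        (a ∙ b) ∙ y ≈⟨ assoc _ _ _ ⟩
        a ∙ (b ∙ y) ≈⟨ ∙-congˡ (cb y) ⟩
        a ∙ (y ∙ b) ≈⟨ sym (assoc _ _ _) ⟩
        (a ∙ y) ∙ b ≈⟨ ∙-congʳ (ca y) ⟩
        (y ∙ a) ∙ b ≈⟨ assoc _ _ _ ⟩
        y ∙ (a ∙ b) ∎
    ; closed⁻¹ = λ {a} ca y → begin
        a ⁻¹ ∙ y       ≈⟨ ∙-congˡ (sym (⁻¹-involutive y)) ⟩
        a ⁻¹ ∙ y ⁻¹ ⁻¹ ≈⟨ sym (⁻¹-anti-homo-∙ (y ⁻¹) a) ⟩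
        (y ⁻¹ ∙ a) ⁻¹  ≈⟨ ⁻¹-cong (sym (ca (y ⁻¹))) ⟩
        (a ∙ y ⁻¹) ⁻¹  ≈⟨ ⁻¹-anti-homo-∙ a (y ⁻¹) ⟩
        y ⁻¹ ⁻¹ ∙ a ⁻¹ ≈⟨ ∙-congʳ (⁻¹-involutive y) ⟩
        y ∙ a ⁻¹       ∎
    ; conj     = λ g ca → central-resp (sym (central⇒σ-trivial ca g)) ca
    }

  -- A simple nonabelian group has trivial centre: the centre is a normal
  -- subgroup, and it cannot be all of G.
  simple-nonabelian⇒centerless : IsNonabelian G → IsSimple G → IsCenterless
  simple-nonabelian⇒centerless (a , b , ab≉ba) (_ , simple) with simple Central center-normal
  ... | inj₁ trivial = trivial
  ... | inj₂ everything = ⊥-elim (ab≉ba (everything a b))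

  fixes⇒commutes : ∀ x (γ : Aut G) → fun γ x ≈ x → Commutes G γ (σ G x)
  fixes⇒commutes x γ γx≈x y = trans (homo-σ γ-hom x y) (σ-congˡ (fun γ y) γx≈x)
    where γ-hom = IsGroupIsomorphism.isGroupHomomorphism (isIso γ)

  -- If γ commutes with σ_x then σ_{γ x} = σ_x, so γ(x) x⁻¹ is central;
  -- in a centreless group this forces γ x = x.
  commutes⇒fixes : IsCenterless → ∀ x (γ : Aut G) → Commutes G γ (σ G x) → fun γ x ≈ x
  commutes⇒fixes centerless x γ commutes =
    x∙y⁻¹≈ε⇒x≈y (f x) x (centerless (f x ∙ x ⁻¹) (σ-trivial⇒central σ-trivial))
    where
    f = fun γ
    module γ = IsGroupIsomorphism (isIso γ)

    same-conjugation : ∀ a → σ G (f x) a ≈ σ G x a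
    same-conjugation a = begin
      σ G (f x) a     ≈⟨ σ-congʳ (f x) (sym fb≈a) ⟩
      σ G (f x) (f b) ≈⟨ sym (homo-σ γ.isGroupHomomorphism x b) ⟩
      f (σ G x b)     ≈⟨ commutes b ⟩
      σ G x (f b)     ≈⟨ σ-congʳ x fb≈a ⟩
      σ G x a         ∎
      where
      b = proj₁ (γ.surjective a)
      fb≈a = proj₂ (γ.surjective a) refl

    σ-trivial : ∀ a → σ G (f x ∙ x ⁻¹) a ≈ a
    σ-trivial a = begin
      σ G (f x ∙ x ⁻¹) a       ≈⟨ sym (σ-∘ (f x) (x ⁻¹) a) ⟩
      σ G (f x) (σ G (x ⁻¹) a) ≈⟨ same-conjugation _ ⟩
      σ G x (σ G (x ⁻¹) a)     ≈⟨ σ-inverseʳ x a ⟩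
      a                        ∎

  conjugates⇒stabilizes : ∀ (e : Aut G) x g → fun e x ≈ σ G g x → Stabilizes G e x
  conjugates⇒stabilizes e x g ex≈gx = into , onto
    where
    f = fun e
    module e = IsGroupIsomorphism (isIso e)
    f-σ = homo-σ e.isGroupHomomorphism

    into : ∀ y → _∈Class_ G y x → _∈Class_ G (f y) x
    into y (h , y≈hx) = f h ∙ g , (begin
      f y                 ≈⟨ e.⟦⟧-cong y≈hx ⟩
      f (σ G h x)         ≈⟨ f-σ h x ⟩
      σ G (f h) (f x)     ≈⟨ σ-congʳ (f h) ex≈gx ⟩
      σ G (f h) (σ G g x) ≈⟨ σ-∘ (f h) g x ⟩
      σ G (f h ∙ g) x     ∎)

    onto : ∀ y → _∈Class_ G y x → ∃[ z ] (_∈Class_ G z x × f z ≈ y)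
    onto y (h , y≈hx) = σ G w x , (w , refl) , (begin
      f (σ G w x)                ≈⟨ f-σ w x ⟩
      σ G (f w) (f x)            ≈⟨ σ-congˡ (f x) fw≈hg⁻¹ ⟩
      σ G (h ∙ g ⁻¹) (f x)       ≈⟨ σ-congʳ (h ∙ g ⁻¹) ex≈gx ⟩
      σ G (h ∙ g ⁻¹) (σ G g x)   ≈⟨ σ-∘ (h ∙ g ⁻¹) g x ⟩
      σ G ((h ∙ g ⁻¹) ∙ g) x     ≈⟨ σ-congˡ x (trans (assoc _ _ _) (trans (∙-congˡ (inverseˡ g)) (identityʳ h))) ⟩
      σ G h x                    ≈⟨ sym y≈hx ⟩
      y                          ∎)
      where
      w = proj₁ (e.surjective (h ∙ g ⁻¹))
      fw≈hg⁻¹ = proj₂ (e.surjective (h ∙ g ⁻¹)) refl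

  -- If e stabilises x^G, then e x = σ_g x for some g, and e factors as σ_g ∘ γ
  -- where γ = σ_{g⁻¹} ∘ e fixes x and hence commutes with σ_x.
  stabilizes⇒Δ : ∀ (e : Aut G) x → Stabilizes G e x → _∈Δ_ G e (σ G x)
  stabilizes⇒Δ e x (into , _) = g , γ , fixes⇒commutes x γ γx≈x , factor
    where
    ex∈class = into x (ε , sym (σ-identity x))
    g = proj₁ ex∈class
    γ = conjugateAut (g ⁻¹) e

    γx≈x : fun γ x ≈ x
    γx≈x = trans (σ-congʳ (g ⁻¹) (proj₂ ex∈class)) (σ-inverseˡ g x)

    factor : ∀ y → fun e y ≈ σ G g (fun γ y)
    factor y = sym (σ-inverseʳ g (fun e y))

lemma2p11 : {c ℓ : Level} (G : Group c ℓ) → IsFiniteGroup G → IsNonabelian G → IsSimple G →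
    (x : Group.Carrier G) → IsInvolution G x →
    (e : Aut G) → Stabilizes G e x ⇔ _∈Δ_ G e (σ G x)
lemma2p11 G _ nonabelian simple x _ e = mk⇔ (stabilizes⇒Δ e x) Δ⇒stabilizes
  where
  open Group G using (trans)
  open Conjugation G
  centerless = simple-nonabelian⇒centerless nonabelian simple

  -- e = σ_g ∘ γ with γ commuting with σ_x; γ fixes x, so e x = σ_g x.
  Δ⇒stabilizes : _∈Δ_ G e (σ G x) → Stabilizes G e x
  Δ⇒stabilizes (g , γ , commutes , factor) =
    conjugates⇒stabilizes e x g
      (trans (factor x) (σ-congʳ g (commutes⇒fixes centerless x γ commutes)))
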